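{- Let $J=(X,k,\mathcal{R})$ be an instance of Binary Constrained Clustering. For every $0<\epsilon\le4$ and $0<\alpha\le\frac{\epsilon}{8k}$ the following holds. Let $\widehat{k}=1$ if $J$ is not $(i,\alpha)$-irreducible for any $i\in\{2,\ldots,k\}$, and otherwise $\widehat{k}=\max\{i : J\text{ is }(i,\alpha)\text{ -irreducible}\}$. Then $\mathrm{OPT}_{\widehat{k}}(J)\le(1+\frac{\epsilon}{4})\mathrm{OPT}(J)$.
   Context: A $k$-tuple $(\mathbf{c}_1,\ldots,\mathbf{c}_k)$ of vectors in $\{0,1\}^m$ satisfies $\mathcal{R}=(R_1,\ldots,R_m)$, $R_i\subseteq\{0,1\}^k$, if $(\mathbf{c}_1[i],\ldots,\mathbf{c}_k[i])\in R_i$ for all $i$. For an instance $J=(X,k,\mathcal{R})$ of Binary Constrained Clustering ($X\subseteq\{0,1\}^m$ finite), $\mathrm{OPT}(J)$ is the minimum of $\mathrm{cost}(X,C)=\sum_{\mathbf{x}\in X}\min_{\mathbf{c}\in C}d_H(\mathbf{x},\mathbf{c})$ over $k$-tuples $C$ satisfying $\mathcal{R}$ ($d_H$ = Hamming distance). For $R\subseteq\{0,1\}^k$ and $I=\{i_1<\cdots<i_s\}\subseteq\{1,\ldots,k\}$, $\mathrm{proj}_I(R)=\{(t[i_1],\ldots,t[i_s]):t\in R\}$ and $\mathrm{proj}_I(\mathcal{R})=(\mathrm{proj}_I(R_1),\ldots,\mathrm{proj}_I(R_m))$. For $i\in\{1,\ldots,k\}$, $\mathrm{OPT}_i(J)=\min\{\mathrm{OPT}(X,i,\mathrm{proj}_I(\mathcal{R}))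 : I\subseteq\{1,\ldots,k\},|I|=i\}$; note $\mathrm{OPT}_k(J)=\mathrm{OPT}(J)$. For $j\in\{2,\ldots,k\}$ and $\alpha>0$, $J$ is $(j,\alpha)$-irreducible if $\mathrm{OPT}_{j-1}(J)\ge(1+\alpha)\mathrm{OPT}_j(J)$.
   Formalization: The parameters ε and α range over the rational numbers. -}

module Defs where

open import Data.Bool using (Bool; true; false; _≟_)
open import Data.Nat using (ℕ; zero; suc; _⊓_; _≤_; _∸_)
open import Data.Fin using (Fin) renaming (_<_ to _<ᶠ_)
open import Data.Vec using (Vec; []; _∷_; lookup; foldr₁; zipWith) renaming (map to vmap)
open import Data.Nat.ListAction using (sum)
open import Data.List using (List) renaming (map to lmap)
open import Data.Product using (Σ; Σ-syntax; _×_)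
open import Data.Empty using (⊥)
open import Relation.Binary.PropositionalEquality using (_≡_)
open import Relation.Nullary.Decidable using (⌊_⌋)
open import Data.Integer using (+_)
open import Data.Rational using (ℚ; _/_; _*_; _+_) renaming (_≤_ to _≤ℚ_)

BVec : ℕ → Set
BVec m = Vec Bool m

dH : ∀ {m} → BVec m → BVec m → ℕ
dH [] [] = 0
dH (a ∷ x) (b ∷ y) = (if ⌊ a ≟ b ⌋ then 0 else 1) Data.Nat.+ dH x y
  where open import Data.Bool using (if_then_else_)

Constraints : ℕ → ℕ → Set₁
Constraints m k = Fin m → BVec k → Set

column : ∀ {m k} → Vec (BVec m) k → Fin m → BVec k
column C i = vmap (λ c → lookup c i) C

Satisfies : ∀ {m k} → Constraints m k → Vec (BVec m) k → Set
Satisfies R C = ∀ i → R i (column C i)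

cost : ∀ {m n} → List (BVec m) → Vec (BVec m) (suc n) → ℕ
cost X C = sum (lmap (λ x → foldr₁ _⊓_ (vmap (dH x) C)) X)

-- IsOPT X k R v : v = OPT(X,k,R), the minimum cost over k-tuples satisfying R.
-- (k = 0 has no OPT value.)
IsOPT : ∀ {m} → List (BVec m) → (k : ℕ) → Constraints m k → ℕ → Set
IsOPT X zero R v = ⊥
IsOPT X (suc n) R v =
  (Σ[ C ∈ Vec (BVec _) (suc n) ] (Satisfies R C × cost X C ≡ v))
  × (∀ (C : Vec (BVec _) (suc n)) → Satisfies R C → v ≤ cost X C)

-- An index set I = {i_1 < … < i_s} ⊆ {1,…,k} is given as a strictly increasing
-- vector of indices of length s.
Increasing : ∀ {k s} → Vec (Fin k) s → Set
Increasing {s = s} ι = ∀ (a b : Fin s) → a <ᶠ b → lookup ι a <ᶠ lookup ι b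

projR : ∀ {k s} → Vec (Fin k) s → (BVec k → Set) → BVec s → Set
projR ι R u = Σ[ t ∈ BVec _ ] (R t × vmap (lookup t) ι ≡ u)

proj : ∀ {m k s} → Vec (Fin k) s → Constraints m k → Constraints m s
proj ι R i = projR ι (R i)

IsOPTi : ∀ {m} → List (BVec m) → (k : ℕ) → Constraints m k → ℕ → ℕ → Set
IsOPTi X k R i v =
  (Σ[ ι ∈ Vec (Fin k) i ] (Increasing ι × IsOPT X i (proj ι R) v))
  × (∀ (ι : Vec (Fin k) i) → Increasing ι → ∀ w → IsOPT X i (proj ι R) w → v ≤ w)

toℚ : ℕ → ℚ
toℚ n = + n / 1

Irreducible : ∀ {m} → List (BVec m) → (k : ℕ) → Constraints m k → ℕ → ℚ → Set
Irreducible X k R j α =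
  ∀ a b → IsOPTi X k R (j ∸ 1) a → IsOPTi X k R j b →
    ((toℚ 1 + α) * toℚ b) ≤ℚ toℚ a

IsKHat : ∀ {m} → List (BVec m) → (k : ℕ) → Constraints m k → ℚ → ℕ → Set
IsKHat X k R α kh =
  ((kh ≡ 1) × (∀ i → 2 ≤ i → i ≤ k → Irreducible X k R i α → ⊥))
  ⊎ ((2 ≤ kh × kh ≤ k × Irreducible X k R kh α)
     × (∀ i → 2 ≤ i → i ≤ k → Irreducible X k R i α → i ≤ kh))
  where open import Data.Sum using (_⊎_)

-- For every level i above k̂ the instance is not (i,α)-irreducible, so OPT_{i-1} < (1+α) OPT_i.
-- Chaining these inequalities from k̂ up to k gives OPT_k̂ ≤ (1+α)^(k-k̂) OPT_k, and since
-- (k-k̂) α ≤ kα ≤ ε/8 ≤ 1/2, the power is at most 1 + 2kα ≤ 1 + ε/4. The OPT_i values are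
-- only characterised, not computed, so the chain is built in the double-negation monad and
-- the decidable conclusion is recovered at the end.
module Submission where

open import Level using (0ℓ)
open import Data.Nat as ℕ using (ℕ; zero; suc; z≤n; s≤s; _∸_) renaming (_≤_ to _≤ℕ_; _<_ to _<ℕ_)
import Data.Nat.Properties as ℕ
open import Data.Nat.Coprimality using (1-coprimeTo) renaming (sym to coprime-sym)
open import Data.Integer using (+_; +≤+)
import Data.Integer.Properties as ℤ
import Data.Integer.Solver as ℤ-Solver
open import Data.Rational
  using (ℚ; mkℚ; *≤*; 0ℚ; 1ℚ; _/_; _+_; _*_; _<_; _≤_; NonNegative; nonNegative; +-*-rawSemiring)
open import Data.Rational.Properties
open import Data.Rational.Solver using (module +-*-Solver)
import Data.Rational.Unnormalised as ℚᵘ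
import Data.Rational.Unnormalised.Properties as ℚᵘ
open import Algebra.Definitions.RawSemiring +-*-rawSemiring using (_^_)
open import Data.Bool using (Bool)
open import Data.Fin using () renaming (_<_ to _<ᶠ_)
open import Data.Vec using (Vec; allFin)
open import Data.Vec.Properties using (map-lookup-allFin; lookup-allFin)
open import Data.List using (List)
open import Data.List.Relation.Unary.Unique.Propositional using (Unique)
open import Data.Product using (∃-syntax; _×_; _,_)
open import Data.Sum using (inj₁; inj₂)
open import Relation.Nullary using (¬_)
open import Relation.Nullary.Negation using (DoubleNegation; ¬¬-Monad; ¬¬-map)
open import Relation.Nullary.Decidable using (decidable-stable)
open import Relation.Binary.PropositionalEquality
open import Effect.Monad using (RawMonad)

open import Defs

-- _/_ normalises through gcd, which does not compute on a variable numerator.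
toℚ≡mkℚ : ∀ n → toℚ n ≡ mkℚ (+ n) 0 (coprime-sym (1-coprimeTo n))
toℚ≡mkℚ n = normalize-coprime (coprime-sym (1-coprimeTo n))

toℚ-mono-≤ : ∀ {m n} → m ≤ℕ n → toℚ m ≤ toℚ n
toℚ-mono-≤ {m} {n} m≤n rewrite toℚ≡mkℚ m | toℚ≡mkℚ n =
  *≤* (ℤ.*-monoʳ-≤-nonNeg (+ 1) (+≤+ m≤n))

toℚ-nonNeg : ∀ n → 0ℚ ≤ toℚ n
toℚ-nonNeg n = toℚ-mono-≤ (z≤n {n})

toℚ-suc : ∀ n → toℚ (suc n) ≡ toℚ n + 1ℚ
toℚ-suc n rewrite toℚ≡mkℚ n | toℚ≡mkℚ (suc n) =
  toℚᵘ-injective (ℚᵘ.≃-trans suc≃+1 (ℚᵘ.≃-sym (toℚᵘ-homo-+ (mkℚ (+ n) 0 (coprime-sym (1-coprimeTo n))) 1ℚ)))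
  where
  open ℤ-Solver.+-*-Solver
  suc≃+1 : ℚᵘ.mkℚᵘ (+ suc n) 0 ℚᵘ.≃ ℚᵘ.mkℚᵘ (+ n) 0 ℚᵘ.+ ℚᵘ.mkℚᵘ (+ 1) 0
  suc≃+1 = ℚᵘ.*≡* (solve 1 (λ x → (con (+ 1) :+ x) :* con (+ 1)
                              := (x :* con (+ 1) :+ con (+ 1) :* con (+ 1)) :* con (+ 1)) refl (+ n))

^-nonNeg : ∀ {p} → 0ℚ ≤ p → ∀ n → 0ℚ ≤ p ^ n
^-nonNeg 0≤p zero = toℚ-nonNeg 1
^-nonNeg {p} 0≤p (suc n) =
  subst (_≤ p * p ^ n) (*-zeroʳ p) (*-monoˡ-≤-nonNeg p {{nonNegative 0≤p}} (^-nonNeg 0≤p n))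

module _ {α : ℚ} (0≤α : 0ℚ ≤ α) where
  private instance
    α-nonNeg : NonNegative α
    α-nonNeg = nonNegative 0≤α
    2-nonNeg : NonNegative (toℚ 2)
    2-nonNeg = nonNegative (toℚ-nonNeg 2)

  1+α-nonNeg : 0ℚ ≤ 1ℚ + α
  1+α-nonNeg = +-mono-≤ (toℚ-nonNeg 1) 0≤α

  2nα : ℕ → ℚ
  2nα n = (toℚ n * α) * toℚ 2

  2nα-mono : ∀ {m n} → m ≤ℕ n → 2nα m ≤ 2nα n
  2nα-mono m≤n = *-monoʳ-≤-nonNeg (toℚ 2) (*-monoʳ-≤-nonNeg α (toℚ-mono-≤ m≤n))

  [1+α]^n≤1+2nα : ∀ n → 2nα n ≤ 1ℚ → (1ℚ + α) ^ n ≤ 1ℚ + 2nα n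
  [1+α]^n≤1+2nα zero _ = ≤-reflexive (solve 1 (λ a → con 1ℚ := con 1ℚ :+ (con (toℚ 0) :* a) :* con (toℚ 2)) refl α)
    where open +-*-Solver
  [1+α]^n≤1+2nα (suc n) 2[n+1]α≤1 = begin
      (1ℚ + α) * (1ℚ + α) ^ n
    ≤⟨ *-monoˡ-≤-nonNeg (1ℚ + α) {{nonNegative 1+α-nonNeg}} ([1+α]^n≤1+2nα n 2nα≤1) ⟩
      (1ℚ + α) * (1ℚ + 2nα n)
    ≡⟨ expand (toℚ n) α ⟩
      (1ℚ + 2nα n) + α + 2nα n * α
    ≤⟨ +-monoʳ-≤ ((1ℚ + 2nα n) + α) (*-monoʳ-≤-nonNeg α 2nα≤1) ⟩
      (1ℚ + 2nα n) + α + 1ℚ * α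
    ≡⟨ collect (toℚ n) α ⟩
      1ℚ + ((toℚ n + 1ℚ) * α) * toℚ 2
    ≡⟨ cong (λ x → 1ℚ + (x * α) * toℚ 2) (sym (toℚ-suc n)) ⟩
      1ℚ + 2nα (suc n) ∎
    where
    open ≤-Reasoning
    open +-*-Solver
    2nα≤1 : 2nα n ≤ 1ℚ
    2nα≤1 = ≤-trans (2nα-mono (ℕ.n≤1+n n)) 2[n+1]α≤1
    expand : ∀ x a → (1ℚ + a) * (1ℚ + (x * a) * toℚ 2) ≡ (1ℚ + (x * a) * toℚ 2) + a + ((x * a) * toℚ 2) * a
    expand = solve 2 (λ x a → (con 1ℚ :+ a) :* (con 1ℚ :+ (x :* a) :* con (toℚ 2))
                           := (con 1ℚ :+ (x :* a) :* con (toℚ 2)) :+ a :+ ((x :* a) :* con (toℚ 2)) :* a) refl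
    collect : ∀ x a → (1ℚ + (x * a) * toℚ 2) + a + 1ℚ * a ≡ 1ℚ + ((x + 1ℚ) * a) * toℚ 2
    collect = solve 2 (λ x a → (con 1ℚ :+ (x :* a) :* con (toℚ 2)) :+ a :+ con 1ℚ :* a
                            := con 1ℚ :+ ((x :+ con 1ℚ) :* a) :* con (toℚ 2)) refl

  [1+α]^n≤1+ε/4 : ∀ {k n ε} → ε ≤ toℚ 4 → (toℚ 8 * toℚ k) * α ≤ ε → n ≤ℕ k →
                  (1ℚ + α) ^ n ≤ 1ℚ + ε * (+ 1 / 4)
  [1+α]^n≤1+ε/4 {k} {n} {ε} ε≤4 8kα≤ε n≤k =
    ≤-trans ([1+α]^n≤1+2nα n (≤-trans 2nα≤ε/4 ε/4≤1)) (+-monoʳ-≤ 1ℚ 2nα≤ε/4)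
    where
    open +-*-Solver
    instance
      ¼-nonNeg : NonNegative (+ 1 / 4)
      ¼-nonNeg = nonNegative {+ 1 / 4} (*≤* (+≤+ (z≤n {1})))
    2kα≡8kα/4 : ∀ x a → (x * a) * toℚ 2 ≡ ((toℚ 8 * x) * a) * (+ 1 / 4)
    2kα≡8kα/4 = solve 2 (λ x a → (x :* a) :* con (toℚ 2) := ((con (toℚ 8) :* x) :* a) :* con (+ 1 / 4)) refl
    2nα≤ε/4 : 2nα n ≤ ε * (+ 1 / 4)
    2nα≤ε/4 = ≤-trans (2nα-mono n≤k)
                (≤-trans (≤-reflexive (2kα≡8kα/4 (toℚ k) α)) (*-monoʳ-≤-nonNeg (+ 1 / 4) 8kα≤ε))
    ε/4≤1 : ε * (+ 1 / 4) ≤ 1ℚ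
    ε/4≤1 = *-monoʳ-≤-nonNeg (+ 1 / 4) ε≤4

allFin-increasing : ∀ {k} → Increasing (allFin k)
allFin-increasing a b a<b = subst₂ _<ᶠ_ (sym (lookup-allFin a)) (sym (lookup-allFin b)) a<b

module _ {m : ℕ} (X : List (BVec m)) (k : ℕ) (R : Constraints m k) where
  open RawMonad (¬¬-Monad {0ℓ})

  IsOPTi-functional : ∀ {i v w} → IsOPTi X k R i v → IsOPTi X k R i w → v ≡ w
  IsOPTi-functional {v = v} {w} ((ι , ι-inc , ι-opt) , v-min) ((κ , κ-inc , κ-opt) , w-min) =
    ℕ.≤-antisym (v-min κ κ-inc w κ-opt) (w-min ι ι-inc v ι-opt)

  IsOPT⇒IsOPT-proj-allFin : ∀ {b} → IsOPT X k R b → IsOPT X k (proj (allFin k) R) b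
  IsOPT⇒IsOPT-proj-allFin {b} = go k R
    where
    go : ∀ k′ (R′ : Constraints m k′) → IsOPT X k′ R′ b → IsOPT X k′ (proj (allFin k′) R′) b
    go (suc n) R′ ((C , C-sat , C-cost) , b-min) =
      (C , (λ i → column C i , C-sat i , map-lookup-allFin (column C i)) , C-cost) ,
      (λ C′ C′-sat → b-min C′ (λ i → unproj i (C′-sat i)))
      where
      unproj : ∀ i {u} → proj (allFin (suc n)) R′ i u → R′ i u
      unproj i (t , t∈R , t≡u) = subst (R′ i) (trans (sym (map-lookup-allFin t)) t≡u) t∈R

  OPTₖ≤OPT : ∀ {c b} → IsOPTi X k R k c → IsOPT X k R b → c ≤ℕ b
  OPTₖ≤OPT (_ , c-min) B = c-min (allFin k) allFin-increasing _ (IsOPT⇒IsOPT-proj-allFin B)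

  ¬Irreducible⇒gap : ∀ {i α} → ¬ Irreducible X k R i α →
    DoubleNegation (∃[ a ] ∃[ b ] IsOPTi X k R (i ∸ 1) a × IsOPTi X k R i b × toℚ a < (1ℚ + α) * toℚ b)
  ¬Irreducible⇒gap ¬irr ¬gap = ¬irr λ a b A B →
    decidable-stable (_ ≤? _) λ ≰ → ¬gap (a , b , A , B , ≰⇒> ≰)

  IsKHat⇒≤ : ∀ {α kh} → IsKHat X k R α kh → 1 ≤ℕ k → kh ≤ℕ k
  IsKHat⇒≤ (inj₁ (refl , _)) 1≤k = 1≤k
  IsKHat⇒≤ (inj₂ ((_ , kh≤k , _) , _)) _ = kh≤k

  IsKHat⇒¬Irreducible : ∀ {α kh} → IsKHat X k R α kh → ∀ i → kh <ℕ i → i ≤ℕ k → ¬ Irreducible X k R i α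
  IsKHat⇒¬Irreducible (inj₁ (refl , none)) i 1<i i≤k = none i 1<i i≤k
  IsKHat⇒¬Irreducible (inj₂ ((2≤kh , _ , _) , maximal)) i kh<i i≤k irr =
    ℕ.<⇒≱ kh<i (maximal i (ℕ.≤-trans 2≤kh (ℕ.<⇒≤ kh<i)) i≤k irr)

  module _ {α : ℚ} (0≤α : 0ℚ ≤ α) {kh : ℕ} (reducible : ∀ i → kh <ℕ i → i ≤ℕ k → ¬ Irreducible X k R i α)
           {a : ℕ} (A : IsOPTi X k R kh a) where
    private instance
      α-nonNeg : NonNegative α
      α-nonNeg = nonNegative 0≤α

    OPTᵢ-growth : ∀ j → j ℕ.+ kh ≤ℕ k →
      DoubleNegation (∃[ v ] IsOPTi X k R (j ℕ.+ kh) v × toℚ a ≤ (1ℚ + α) ^ j * toℚ v)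
    OPTᵢ-growth zero _ = pure (a , A , ≤-reflexive (sym (*-identityˡ (toℚ a))))
    OPTᵢ-growth (suc j) j+kh<k = do
      (v , V , a≤v) ← OPTᵢ-growth j (ℕ.≤-trans (ℕ.n≤1+n _) j+kh<k)
      (a′ , b′ , A′ , B′ , a′<b′) ← ¬Irreducible⇒gap {α = α} (reducible (suc (j ℕ.+ kh)) (s≤s (ℕ.m≤n+m kh j)) j+kh<k)
      pure (b′ , B′ , step b′ (IsOPTi-functional V A′) a≤v a′<b′)
      where
      step : ∀ {v a′} b′ → v ≡ a′ → toℚ a ≤ (1ℚ + α) ^ j * toℚ v → toℚ a′ < (1ℚ + α) * toℚ b′ →
             toℚ a ≤ (1ℚ + α) ^ suc j * toℚ b′
      step b′ refl a≤v a′<b′ = begin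
          toℚ a
        ≤⟨ a≤v ⟩
          _
        ≤⟨ *-monoˡ-≤-nonNeg ((1ℚ + α) ^ j) {{nonNegative (^-nonNeg (1+α-nonNeg 0≤α) j)}} (<⇒≤ a′<b′) ⟩
          (1ℚ + α) ^ j * ((1ℚ + α) * toℚ b′)
        ≡⟨ solve 3 (λ p q r → p :* (q :* r) := (q :* p) :* r) refl ((1ℚ + α) ^ j) (1ℚ + α) (toℚ b′) ⟩
          (1ℚ + α) ^ suc j * toℚ b′ ∎
        where
        open ≤-Reasoning
        open +-*-Solver

    OPTₖ̂≤[1+α]^[k-k̂]*OPT : ∀ {b} → kh ≤ℕ k → IsOPT X k R b →
      DoubleNegation (toℚ a ≤ (1ℚ + α) ^ (k ∸ kh) * toℚ b)
    OPTₖ̂≤[1+α]^[k-k̂]*OPT {b} kh≤k B = do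
      (c , C , a≤c) ← OPTᵢ-growth (k ∸ kh) (ℕ.≤-reflexive k-kh+kh≡k)
      pure (≤-trans a≤c (*-monoˡ-≤-nonNeg ((1ℚ + α) ^ (k ∸ kh)) {{nonNegative (^-nonNeg (1+α-nonNeg 0≤α) (k ∸ kh))}}
                           (toℚ-mono-≤ (OPTₖ≤OPT (subst (λ i → IsOPTi X k R i c) k-kh+kh≡k C) B))))
      where
      k-kh+kh≡k : (k ∸ kh) ℕ.+ kh ≡ k
      k-kh+kh≡k = ℕ.m∸n+n≡m kh≤k

lemma6 : ∀ {m : ℕ} (X : List (Vec Bool m)) → Unique X →
         (k : ℕ) → 1 ≤ℕ k → (R : Constraints m k) →
         (ε α : ℚ) → 0ℚ < ε → ε ≤ toℚ 4 →
         0ℚ < α → (toℚ 8 * toℚ k) * α ≤ ε →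
         (kh : ℕ) → IsKHat X k R α kh →
         ∀ (a b : ℕ) → IsOPTi X k R kh a → IsOPT X k R b →
         toℚ a ≤ (1ℚ + ε * (+ 1 / 4)) * toℚ b
lemma6 X _ k 1≤k R ε α _ ε≤4 0<α 8kα≤ε kh k̂ a b A B =
  decidable-stable (toℚ a ≤? (1ℚ + ε * (+ 1 / 4)) * toℚ b) (¬¬-map bound OPTₖ̂-bound)
  where
  0≤α : 0ℚ ≤ α
  0≤α = <⇒≤ 0<α
  OPTₖ̂-bound : DoubleNegation (toℚ a ≤ (1ℚ + α) ^ (k ∸ kh) * toℚ b)
  OPTₖ̂-bound = OPTₖ̂≤[1+α]^[k-k̂]*OPT X k R 0≤α (IsKHat⇒¬Irreducible X k R {α} {kh} k̂) A
                 (IsKHat⇒≤ X k R {α} {kh} k̂ 1≤k) B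
  bound : toℚ a ≤ (1ℚ + α) ^ (k ∸ kh) * toℚ b → toℚ a ≤ (1ℚ + ε * (+ 1 / 4)) * toℚ b
  bound a≤ = ≤-trans a≤ (*-monoʳ-≤-nonNeg (toℚ b) {{nonNegative (toℚ-nonNeg b)}}
                           ([1+α]^n≤1+ε/4 0≤α ε≤4 8kα≤ε (ℕ.m∸n≤m k kh)))
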